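{- In a Constructor-Blocker game on $K_n$, assume that Blocker, after each move of Constructor, claims whenever possible an unclaimed edge with both endpoints in the connected component of Constructor's graph containing the edge Constructor just claimed. If at the end of the game some connected component $C$ of Constructor's graph has $r$ vertices, then at least $\dfrac{\binom{r}{2}-\lfloor r/2\rfloor}{2}$ edges between vertices of $C$ are not claimed by Constructor.
   Context: In a Constructor-Blocker game, Constructor and Blocker alternately claim previously unclaimed edges of $K_n$ (Constructor may be subject to restrictions on which edges she may claim; Blocker is unrestricted). Constructor's graph is the graph on $V(K_n)$ of edges she has claimed. -}

module Defs where

open import Data.Nat using (ℕ; _≤_; _+_; _*_; _/_)
open import Data.Nat.Combinatorics using (_C_)
open import Data.Fin using (Fin; _<_)
open import Data.Product using (_×_; _,_; ∃; ∃-syntax; proj₁; proj₂)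
open import Data.Sum using (_⊎_)
open import Data.List using (List; []; _∷_; _++_; length; [_])
open import Data.List.Membership.Propositional using (_∈_; _∉_)
open import Data.List.Relation.Unary.All using (All)
open import Data.List.Relation.Unary.Unique.Propositional using (Unique)
open import Relation.Binary.PropositionalEquality using (_≡_)
open import Function.Bundles using (_⇔_)

-- An edge of K_n is stored canonically as an ordered pair (a , b) with a < b.
Edge : ℕ → Set
Edge n = Fin n × Fin n

IsEdge : {n : ℕ} → Edge n → Set
IsEdge (a , b) = a < b

-- Moves at even positions (0,2,4,...) are Constructor's, odd positions Blocker's.
mutual
  evens : {A : Set} → List A → List A
  evens [] = []
  evens (x ∷ xs) = x ∷ odds xs

  odds : {A : Set} → List A → List A
  odds [] = []
  odds (x ∷ xs) = evens xs

Adj : {n : ℕ} → List (Edge n) → Fin n → Fin n → Set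
Adj G v w = ((v , w) ∈ G) ⊎ ((w , v) ∈ G)

data Conn {n : ℕ} (G : List (Edge n)) : Fin n → Fin n → Set where
  here : ∀ {v} → Conn G v v
  step : ∀ {u v w} → Conn G u v → Adj G v w → Conn G u w

ConstructorGraph : {n : ℕ} → List (Edge n) → List (Edge n)
ConstructorGraph = evens

LegalPlay : {n : ℕ} → List (Edge n) → Set
LegalPlay play = All IsEdge play × Unique play

InComponentOf : {n : ℕ} → List (Edge n) → Edge n → Edge n → Set
InComponentOf G c e = Conn G (proj₁ c) (proj₁ e) × Conn G (proj₁ c) (proj₂ e)

BlockerFollowsStrategy : {n : ℕ} → List (Edge n) → Set
BlockerFollowsStrategy {n} play =
  ∀ (pre : List (Edge n)) (c : Edge n) (rest : List (Edge n)) →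
  play ≡ pre ++ (c ∷ rest) →
  (∃[ k ] length pre ≡ 2 * k) →   -- c is a Constructor move
  ∃[ e ] (IsEdge e × e ∉ pre ++ [ c ]
          × InComponentOf (ConstructorGraph (pre ++ [ c ])) c e) →
  ∃[ b ] ∃[ rest' ] (rest ≡ b ∷ rest'
          × InComponentOf (ConstructorGraph (pre ++ [ c ])) c b)

IsComponent : {n : ℕ} → List (Edge n) → List (Fin n) → Set
IsComponent {n} G Vs = Unique Vs × ∃[ x ] (∀ (v : Fin n) → (v ∈ Vs) ⇔ Conn G x v)

ManyNonConstructorEdges : {n : ℕ} → List (Edge n) → List (Fin n) → Set
ManyNonConstructorEdges {n} G Vs =
  ∃[ L ] (Unique L
    × All (λ e → IsEdge e × proj₁ e ∈ Vs × proj₂ e ∈ Vs × e ∉ G) L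
    × ((length Vs) C 2) ≤ 2 * length L + length Vs / 2)

-- Write G and B for the edges of Constructor and Blocker, and e_X(W) for the number of edges of X
-- with both endpoints in W. Blocker's strategy keeps, for every union W of components of G,
--   e_G(W) ≤ e_B(W) + ⌊|W|/2⌋.
-- When Constructor claims c inside W, either Blocker answers inside the new component K of c, so
-- both sides grow by one, or no edge of K_n inside K is left unclaimed. Then e_G(K) + e_B(K) is
-- C(|K|,2), and as C(k,2) + ⌊k/2⌋ is always even, the bound e_G(K) ≤ e_B(K) + ⌊|K|/2⌋ + 1 improves
-- by one; the rest W ∖ K is a union of old components and keeps its bound. For a final component
-- of size r, Blocker's edges inside it are not Constructor's, so C(r,2) ≤ 2·(unclaimed by G) + ⌊r/2⌋.

module Submission where

open import Defs
open import Data.Nat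
  using (ℕ; suc; _+_; _*_; _≤_; _/_; ⌊_/2⌋; z≤n; s≤s; s≤s⁻¹)
open import Data.Nat.Properties hiding (_≟_)
open import Data.Nat.DivMod using (m/n≡1+[m∸n]/n)
open import Data.Nat.Combinatorics using (_C_; nCk+nC[k+1]≡[n+1]C[k+1]; nC1≡n)
open import Data.Nat.Tactic.RingSolver using (solve-∀)
open import Data.Fin using (Fin; _≟_)
import Data.Fin.Properties as Fin
open import Data.List using (List; []; _∷_; _++_; [_]; length; filter; map)
open import Data.List.Properties using (length-++; filter-++; filter-accept; filter-reject; length-map; ++-assoc; ++-identityʳ)
open import Data.List.Membership.Propositional using (_∈_; _∉_)
open import Data.List.Membership.Propositional.Properties
  using (∈-++⁺ˡ; ∈-++⁺ʳ; ∈-++⁻; ∈-∃++; ∈-map⁺; ∈-map⁻; ∈-filter⁺; ∈-filter⁻)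
import Data.List.Membership.DecPropositional as DecMembership
open import Data.List.Relation.Binary.Subset.Propositional using (_⊆_)
open import Data.List.Relation.Unary.Any using (here; there)
open import Data.List.Relation.Unary.All as All using (All; []; _∷_)
open import Data.List.Relation.Unary.All.Properties using (++⁻ˡ)
open import Data.List.Relation.Unary.AllPairs using ([]; _∷_)
open import Data.List.Relation.Unary.Unique.Propositional using (Unique)
open import Data.List.Relation.Unary.Unique.Propositional.Properties
  using (filter⁺; map⁺) renaming (++⁺ to Unique-++⁺)
open import Data.Product using (_×_; _,_; ∃-syntax; proj₁; proj₂)
open import Data.Product.Properties using (≡-dec)
open import Data.Sum using (_⊎_; inj₁; inj₂; swap) renaming ([_,_] to either)
import Data.Sum as Sum
open import Data.Empty using (⊥-elim)
open import Function.Base using (_∘_)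
open import Function.Bundles using (Equivalence)
open import Relation.Binary.Definitions using (tri<; tri≈; tri>)
open import Relation.Nullary using (¬_; Dec; yes; no; contradiction)
open import Relation.Nullary.Decidable using (_×-dec_; _⊎-dec_; map′)
open import Level using (0ℓ)
open import Relation.Unary using (Pred; Decidable; ∁)
open import Relation.Unary.Properties using (∁?)
open import Relation.Binary.PropositionalEquality
  using (_≡_; _≢_; refl; sym; trans; cong; cong₂; subst; subst₂; module ≡-Reasoning)

⌊n/2⌋≡n/2 : ∀ n → ⌊ n /2⌋ ≡ n / 2
⌊n/2⌋≡n/2 0 = refl
⌊n/2⌋≡n/2 1 = refl
⌊n/2⌋≡n/2 (suc (suc n)) =
  trans (cong suc (⌊n/2⌋≡n/2 n)) (sym (m/n≡1+[m∸n]/n {suc (suc n)} {2} (s≤s (s≤s z≤n))))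

⌊m/2⌋+⌊n/2⌋≤⌊m+n/2⌋ : ∀ m n → ⌊ m /2⌋ + ⌊ n /2⌋ ≤ ⌊ m + n /2⌋
⌊m/2⌋+⌊n/2⌋≤⌊m+n/2⌋ 0 n = ≤-refl
⌊m/2⌋+⌊n/2⌋≤⌊m+n/2⌋ 1 n = ⌊n/2⌋-mono (n≤1+n n)
⌊m/2⌋+⌊n/2⌋≤⌊m+n/2⌋ (suc (suc m)) n = s≤s (⌊m/2⌋+⌊n/2⌋≤⌊m+n/2⌋ m n)

m+m≢1+n+n : ∀ m n → m + m ≢ suc (n + n)
m+m≢1+n+n m n eq = 1+n≢n (trans (sym eq) (cong (λ k → k + k) m≡n))
  where
  m≡n : m ≡ n
  m≡n = trans (n≡⌊n+n/2⌋ m) (trans (cong ⌊_/2⌋ eq) (sym (n≡⌈n+n/2⌉ n)))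

m≤1+n∧m+n-even⇒m≤n : ∀ {m n o} → m ≤ suc n → m + n ≡ o + o → m ≤ n
m≤1+n∧m+n-even⇒m≤n {m} {n} {o} m≤1+n even with m≤n⇒m<n∨m≡n m≤1+n
... | inj₁ m<1+n = s≤s⁻¹ m<1+n
... | inj₂ refl  = contradiction (sym even) (m+m≢1+n+n o n)

[2+n]C2≡1+n+[n+nC2] : ∀ n → suc (suc n) C 2 ≡ suc n + (n + n C 2)
[2+n]C2≡1+n+[n+nC2] n = begin
  suc (suc n) C 2           ≡⟨ nCk+nC[k+1]≡[n+1]C[k+1] (suc n) 1 ⟨
  suc n C 1 + suc n C 2     ≡⟨ cong₂ _+_ (nC1≡n (suc n)) (sym (nCk+nC[k+1]≡[n+1]C[k+1] n 1)) ⟩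
  suc n + (n C 1 + n C 2)   ≡⟨ cong (λ k → suc n + (k + n C 2)) (nC1≡n n) ⟩
  suc n + (n + n C 2)       ∎
  where open ≡-Reasoning

nC2+⌊n/2⌋-even : ∀ n → ∃[ m ] n C 2 + ⌊ n /2⌋ ≡ m + m
nC2+⌊n/2⌋-even 0 = 0 , refl
nC2+⌊n/2⌋-even 1 = 0 , refl
nC2+⌊n/2⌋-even (suc (suc n)) with nC2+⌊n/2⌋-even n
... | m , even = suc (n + m) , (begin
  suc (suc n) C 2 + suc ⌊ n /2⌋         ≡⟨ cong (_+ suc ⌊ n /2⌋) ([2+n]C2≡1+n+[n+nC2] n) ⟩
  suc n + (n + n C 2) + suc ⌊ n /2⌋     ≡⟨ regroup n (n C 2) ⌊ n /2⌋ ⟩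
  suc (suc (n + n + (n C 2 + ⌊ n /2⌋))) ≡⟨ cong (λ k → suc (suc (n + n + k))) even ⟩
  suc (suc (n + n + (m + m)))           ≡⟨ regroup′ n m ⟩
  suc (n + m) + suc (n + m)             ∎)
  where
  open ≡-Reasoning
  regroup : ∀ n c h → suc n + (n + c) + suc h ≡ suc (suc (n + n + (c + h)))
  regroup = solve-∀
  regroup′ : ∀ n m → suc (suc (n + n + (m + m))) ≡ suc (n + m) + suc (n + m)
  regroup′ = solve-∀

module _ {A : Set} where

  ∈-++-∷⇒∈-++ : ∀ {x y : A} ys {zs} → y ∈ ys ++ x ∷ zs → y ≢ x → y ∈ ys ++ zs
  ∈-++-∷⇒∈-++ ys y∈ y≢x with ∈-++⁻ ys y∈
  ... | inj₁ y∈ys         = ∈-++⁺ˡ y∈ys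
  ... | inj₂ (here y≡x)   = contradiction y≡x y≢x
  ... | inj₂ (there y∈zs) = ∈-++⁺ʳ ys y∈zs

  Unique-⊆⇒length≤ : ∀ {xs ys : List A} → Unique xs → xs ⊆ ys → length xs ≤ length ys
  Unique-⊆⇒length≤ {[]}     _              _  = z≤n
  Unique-⊆⇒length≤ {x ∷ xs} (x∉xs ∷ uxs) xs⊆ys with ∈-∃++ (xs⊆ys (here refl))
  ... | ys₁ , ys₂ , refl = begin
    suc (length xs)             ≤⟨ s≤s (Unique-⊆⇒length≤ uxs xs⊆ys₁ys₂) ⟩
    suc (length (ys₁ ++ ys₂))   ≡⟨ cong suc (length-++ ys₁) ⟩
    suc (length ys₁ + length ys₂) ≡⟨ +-suc (length ys₁) (length ys₂) ⟨
    length ys₁ + length (x ∷ ys₂) ≡⟨ length-++ ys₁ ⟨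
    length (ys₁ ++ x ∷ ys₂)     ∎
    where
    open ≤-Reasoning
    xs⊆ys₁ys₂ : xs ⊆ ys₁ ++ ys₂
    xs⊆ys₁ys₂ y∈xs = ∈-++-∷⇒∈-++ ys₁ (xs⊆ys (there y∈xs)) λ { refl → All.lookup x∉xs y∈xs refl }

  length-filter+length-filter-∁ : ∀ {P : Pred A 0ℓ} (P? : Decidable P) xs →
                                  length (filter P? xs) + length (filter (∁? P?) xs) ≡ length xs
  length-filter+length-filter-∁ P? []       = refl
  length-filter+length-filter-∁ P? (x ∷ xs) with P? x
  ... | yes _ = cong suc (length-filter+length-filter-∁ P? xs)
  ... | no  _ = trans (+-suc _ _) (cong suc (length-filter+length-filter-∁ P? xs))

  -- Kept opaque so that unification can recover the list being counted.
  opaque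
    count : {P : Pred A 0ℓ} → Decidable P → List A → ℕ
    count P? xs = length (filter P? xs)

    count≡length-filter : ∀ {P : Pred A 0ℓ} (P? : Decidable P) xs → count P? xs ≡ length (filter P? xs)
    count≡length-filter P? xs = refl

  module _ {P : Pred A 0ℓ} (P? : Decidable P) where

    opaque
      unfolding count
      count-++ : ∀ xs ys → count P? (xs ++ ys) ≡ count P? xs + count P? ys
      count-++ xs ys = trans (cong length (filter-++ P? xs ys)) (length-++ (filter P? xs))

      count-∷ʳ-accept : ∀ xs {x} → P x → count P? (xs ++ [ x ]) ≡ suc (count P? xs)
      count-∷ʳ-accept xs px = trans (count-++ xs [ _ ])
        (trans (cong (λ ys → count P? xs + length ys) (filter-accept P? px)) (+-comm _ 1))

      count-∷ʳ-reject : ∀ xs {x} → ¬ P x → count P? (xs ++ [ x ]) ≡ count P? xs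
      count-∷ʳ-reject xs ¬px = trans (count-++ xs [ _ ])
        (trans (cong (λ ys → count P? xs + length ys) (filter-reject P? ¬px)) (+-identityʳ _))

      count≡count-evens+count-odds : ∀ xs → count P? xs ≡ count P? (evens xs) + count P? (odds xs)
      count≡count-evens+count-odds []       = refl
      count≡count-evens+count-odds (x ∷ xs) with P? x
      ... | yes _ = cong suc (trans (count≡count-evens+count-odds xs) (+-comm (count P? (evens xs)) _))
      ... | no  _ = trans (count≡count-evens+count-odds xs) (+-comm (count P? (evens xs)) _)

  module _ {P Q S : Pred A 0ℓ} (P? : Decidable P) (Q? : Decidable Q) (S? : Decidable S)
         (P∩Q=∅ : ∀ {x} → P x → ¬ Q x) (P⊆S : ∀ {x} → P x → S x) (Q⊆S : ∀ {x} → Q x → S x) where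

    opaque
      unfolding count
      count-disjoint≤count : ∀ xs → count P? xs + count Q? xs ≤ count S? xs
      count-disjoint≤count [] = z≤n
      count-disjoint≤count (x ∷ xs) with P? x | Q? x | S? x
      ... | yes px | yes qx | _      = contradiction qx (P∩Q=∅ px)
      ... | yes px | no  _  | no ¬sx = contradiction (P⊆S px) ¬sx
      ... | no  _  | yes qx | no ¬sx = contradiction (Q⊆S qx) ¬sx
      ... | yes _  | no  _  | yes _  = s≤s (count-disjoint≤count xs)
      ... | no  _  | yes _  | yes _  =
        subst (_≤ suc (count S? xs)) (sym (+-suc _ _)) (s≤s (count-disjoint≤count xs))
      ... | no  _  | no  _  | yes _  = m≤n⇒m≤1+n (count-disjoint≤count xs)
      ... | no  _  | no  _  | no  _  = count-disjoint≤count xs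

      count≤count-covering : ∀ xs → (∀ {x} → x ∈ xs → S x → P x ⊎ Q x) →
                             count S? xs ≤ count P? xs + count Q? xs
      count≤count-covering []       _     = z≤n
      count≤count-covering (x ∷ xs) cover with S? x | P? x | Q? x
      ... | _      | yes px | yes qx = contradiction qx (P∩Q=∅ px)
      ... | no ¬sx | yes px | _      = contradiction (P⊆S px) ¬sx
      ... | no ¬sx | _      | yes qx = contradiction (Q⊆S qx) ¬sx
      ... | yes sx | no ¬px | no ¬qx = ⊥-elim (either ¬px ¬qx (cover (here refl) sx))
      ... | yes _  | yes _  | no  _  = s≤s (count≤count-covering xs (cover ∘ there))
      ... | yes _  | no  _  | yes _  =
        subst (suc (count S? xs) ≤_) (sym (+-suc _ _)) (s≤s (count≤count-covering xs (cover ∘ there)))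
      ... | no  _  | no  _  | no  _  = count≤count-covering xs (cover ∘ there)

module _ {n : ℕ} where

  private
    variable
      G H : List (Edge n)
      u v w : Fin n

  Adj-sym : Adj G v w → Adj G w v
  Adj-sym = swap

  Adj-mono : G ⊆ H → Adj G v w → Adj H v w
  Adj-mono G⊆H = Sum.map G⊆H G⊆H

  Conn-mono : G ⊆ H → Conn G v w → Conn H v w
  Conn-mono G⊆H here         = here
  Conn-mono G⊆H (step p adj) = step (Conn-mono G⊆H p) (Adj-mono G⊆H adj)

  Conn-trans : Conn G u v → Conn G v w → Conn G u w
  Conn-trans p here         = p
  Conn-trans p (step q adj) = step (Conn-trans p q) adj

  Conn-sym : Conn G v w → Conn G w v
  Conn-sym here         = here
  Conn-sym (step p adj) = Conn-trans (step here (Adj-sym adj)) (Conn-sym p)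

  Conn-[] : Conn [] v w → v ≡ w
  Conn-[] here                = refl
  Conn-[] (step _ (inj₁ ()))
  Conn-[] (step _ (inj₂ ()))

  Conn-∷⁻ : ∀ {a b} → Conn ((a , b) ∷ G) v w →
            Conn G v w ⊎ ((Conn G v a ⊎ Conn G v b) × (Conn G a w ⊎ Conn G b w))
  Conn-∷⁻ here = inj₁ here
  Conn-∷⁻ (step p adj) with Conn-∷⁻ p | adj
  ... | inj₁ q       | inj₁ (there e)   = inj₁ (step q (inj₁ e))
  ... | inj₁ q       | inj₂ (there e)   = inj₁ (step q (inj₂ e))
  ... | inj₁ q       | inj₁ (here refl) = inj₂ (inj₁ q , inj₂ here)
  ... | inj₁ q       | inj₂ (here refl) = inj₂ (inj₂ q , inj₁ here)
  ... | inj₂ (s , t) | inj₁ (there e)   = inj₂ (s , Sum.map (λ c → step c (inj₁ e)) (λ c → step c (inj₁ e)) t)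
  ... | inj₂ (s , t) | inj₂ (there e)   = inj₂ (s , Sum.map (λ c → step c (inj₂ e)) (λ c → step c (inj₂ e)) t)
  ... | inj₂ (s , _) | inj₁ (here refl) = inj₂ (s , inj₂ here)
  ... | inj₂ (s , _) | inj₂ (here refl) = inj₂ (s , inj₁ here)

  Conn-∷⁺ : ∀ {a b} → Conn G v w ⊎ ((Conn G v a ⊎ Conn G v b) × (Conn G a w ⊎ Conn G b w)) →
            Conn ((a , b) ∷ G) v w
  Conn-∷⁺ (inj₁ q) = Conn-mono there q
  Conn-∷⁺ {G = G} {a = a} {b} (inj₂ (s , t)) = Conn-trans (toA s) (fromA t)
    where
    a~b : Conn ((a , b) ∷ G) a b
    a~b = step here (inj₁ (here refl))
    toA : ∀ {x} → Conn G x a ⊎ Conn G x b → Conn ((a , b) ∷ G) x a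
    toA (inj₁ q) = Conn-mono there q
    toA (inj₂ q) = Conn-trans (Conn-mono there q) (Conn-sym a~b)
    fromA : ∀ {x} → Conn G a x ⊎ Conn G b x → Conn ((a , b) ∷ G) a x
    fromA (inj₁ q) = Conn-mono there q
    fromA (inj₂ q) = Conn-trans a~b (Conn-mono there q)

  Conn? : (G : List (Edge n)) → ∀ v w → Dec (Conn G v w)
  Conn? []            v w = map′ (λ { refl → here }) Conn-[] (v ≟ w)
  Conn? ((a , b) ∷ G) v w = map′ Conn-∷⁺ Conn-∷⁻
    (Conn? G v w ⊎-dec ((Conn? G v a ⊎-dec Conn? G v b) ×-dec (Conn? G a w ⊎-dec Conn? G b w)))

  InComponentOf? : ∀ G c e → Dec (InComponentOf {n} G c e)
  InComponentOf? G c e = Conn? G (proj₁ c) (proj₁ e) ×-dec Conn? G (proj₁ c) (proj₂ e)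

  Closed : List (Edge n) → Pred (Fin n) 0ℓ → Set
  Closed G Q = ∀ {v w} → Adj G v w → Q v → Q w

  Closed-Conn : ∀ {Q} → Closed G Q → Q v → Conn G v w → Q w
  Closed-Conn closed qv here         = qv
  Closed-Conn closed qv (step p adj) = closed adj (Closed-Conn closed qv p)

  Closed-++ˡ : ∀ {Q} → Closed (G ++ H) Q → Closed G Q
  Closed-++ˡ closed adj = closed (Adj-mono ∈-++⁺ˡ adj)

  Conn-closed : Closed G (Conn G u)
  Conn-closed adj p = step p adj

  ∁-closed : ∀ {Q} → Closed G Q → Closed G (∁ Q)
  ∁-closed closed adj ¬qv qw = ¬qv (closed (Adj-sym adj) qw)

module _ {n : ℕ} where

  open DecMembership (_≟_ {n}) using (_∈?_)

  private
    variable
      v w : Fin n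

  Within : List (Fin n) → Pred (Edge n) 0ℓ
  Within W e = proj₁ e ∈ W × proj₂ e ∈ W

  within? : ∀ W → Decidable (Within W)
  within? W e = (proj₁ e ∈? W) ×-dec (proj₂ e ∈? W)

  #within : List (Fin n) → List (Edge n) → ℕ
  #within W = count (within? W)

  _∈ₑ?_ : (e : Edge n) (G : List (Edge n)) → Dec (e ∈ G)
  _∈ₑ?_ = DecMembership._∈?_ (≡-dec _≟_ _≟_)

  orient : Fin n → Fin n → Edge n
  orient v w with Fin.<-cmp v w
  ... | tri< _ _ _ = v , w
  ... | tri≈ _ _ _ = v , w
  ... | tri> _ _ _ = w , v

  orient-cases : ∀ v w → orient v w ≡ (v , w) ⊎ orient v w ≡ (w , v)
  orient-cases v w with Fin.<-cmp v w
  ... | tri< _ _ _ = inj₁ refl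
  ... | tri≈ _ _ _ = inj₁ refl
  ... | tri> _ _ _ = inj₂ refl

  orient-isEdge : v ≢ w → IsEdge (orient v w)
  orient-isEdge {v} {w} v≢w with Fin.<-cmp v w
  ... | tri< v<w _ _ = v<w
  ... | tri≈ _ v≡w _ = contradiction v≡w v≢w
  ... | tri> _ _ w<v = w<v

  orient-< : ∀ {a b} → IsEdge (a , b) → orient a b ≡ (a , b)
  orient-< {a} {b} a<b with Fin.<-cmp a b
  ... | tri< _ _ _   = refl
  ... | tri≈ _ _ _   = refl
  ... | tri> ¬a<b _ _ = contradiction a<b ¬a<b

  orient-> : ∀ {a b} → IsEdge (a , b) → orient b a ≡ (a , b)
  orient-> {a} {b} a<b with Fin.<-cmp b a
  ... | tri< b<a _ _ = contradiction b<a (Fin.<-asym a<b)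
  ... | tri≈ _ b≡a _ = contradiction (sym b≡a) (Fin.<⇒≢ a<b)
  ... | tri> _ _ _   = refl

  orient-injective : ∀ {v w w′} → orient v w ≡ orient v w′ → w ≡ w′
  orient-injective {v} {w} {w′} eq with orient-cases v w | orient-cases v w′
  ... | inj₁ e | inj₁ e′ = cong proj₂ (trans (sym e) (trans eq e′))
  ... | inj₁ e | inj₂ e′ = let p = trans (sym e) (trans eq e′) in trans (cong proj₂ p) (cong proj₁ p)
  ... | inj₂ e | inj₁ e′ = let p = trans (sym e) (trans eq e′) in trans (cong proj₁ p) (cong proj₂ p)
  ... | inj₂ e | inj₂ e′ = cong proj₁ (trans (sym e) (trans eq e′))

  completeGraph : List (Fin n) → List (Edge n)
  completeGraph []      = []
  completeGraph (v ∷ W) = map (orient v) W ++ completeGraph W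

  length-completeGraph : ∀ W → length (completeGraph W) ≡ length W C 2
  length-completeGraph []      = refl
  length-completeGraph (v ∷ W) = begin
    length (map (orient v) W ++ completeGraph W)          ≡⟨ length-++ (map (orient v) W) ⟩
    length (map (orient v) W) + length (completeGraph W)  ≡⟨ cong₂ _+_ (length-map (orient v) W) (length-completeGraph W) ⟩
    length W + length W C 2                          ≡⟨ cong (_+ length W C 2) (nC1≡n (length W)) ⟨
    length W C 1 + length W C 2                      ≡⟨ nCk+nC[k+1]≡[n+1]C[k+1] (length W) 1 ⟩
    suc (length W) C 2                               ∎
    where open ≡-Reasoning

  ∈-completeGraph⁻ : ∀ {W e} → Unique W → e ∈ completeGraph W → IsEdge e × Within W e
  ∈-completeGraph⁻ {v ∷ W} (v∉W ∷ uW) e∈ with ∈-++⁻ (map (orient v) W) e∈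
  ... | inj₂ e∈complete with ∈-completeGraph⁻ uW e∈complete
  ...   | isEdge , a∈W , b∈W = isEdge , there a∈W , there b∈W
  ∈-completeGraph⁻ {v ∷ W} (v∉W ∷ uW) e∈ | inj₁ e∈map with ∈-map⁻ (orient v) e∈map
  ... | w , w∈W , refl with orient-cases v w
  ...   | inj₁ eq = orient-isEdge (All.lookup v∉W w∈W) , subst (Within (v ∷ W)) (sym eq) (here refl , there w∈W)
  ...   | inj₂ eq = orient-isEdge (All.lookup v∉W w∈W) , subst (Within (v ∷ W)) (sym eq) (there w∈W , here refl)

  ∈-completeGraph⁺ : ∀ {W e} → IsEdge e → Within W e → e ∈ completeGraph W
  ∈-completeGraph⁺ {v ∷ W} a<b (here refl , here refl) = contradiction refl (Fin.<⇒≢ a<b)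
  ∈-completeGraph⁺ {v ∷ W} a<b (here refl , there b∈W) =
    ∈-++⁺ˡ (subst (_∈ map (orient v) W) (orient-< a<b) (∈-map⁺ (orient v) b∈W))
  ∈-completeGraph⁺ {v ∷ W} a<b (there a∈W , here refl) =
    ∈-++⁺ˡ (subst (_∈ map (orient v) W) (orient-> a<b) (∈-map⁺ (orient v) a∈W))
  ∈-completeGraph⁺ {v ∷ W} a<b (there a∈W , there b∈W) =
    ∈-++⁺ʳ (map (orient v) W) (∈-completeGraph⁺ a<b (a∈W , b∈W))

  completeGraph-unique : ∀ {W} → Unique W → Unique (completeGraph W)
  completeGraph-unique {[]}    []          = []
  completeGraph-unique {v ∷ W} (v∉W ∷ uW) =
    Unique-++⁺ (map⁺ orient-injective uW) (completeGraph-unique uW) disjoint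
    where
    disjoint : ∀ {e} → ¬ (e ∈ map (orient v) W × e ∈ completeGraph W)
    disjoint (e∈map , e∈complete) with ∈-map⁻ (orient v) e∈map | ∈-completeGraph⁻ uW e∈complete
    ... | w , _ , refl | _ , a∈W , b∈W with orient-cases v w
    ...   | inj₁ eq = All.lookup v∉W (subst (λ e → proj₁ e ∈ W) eq a∈W) refl
    ...   | inj₂ eq = All.lookup v∉W (subst (λ e → proj₂ e ∈ W) eq b∈W) refl

  #within≡length-completeGraph : ∀ {W Y} → Unique W → Unique Y → All IsEdge Y →
                            (∀ {e} → IsEdge e → Within W e → e ∈ Y) → #within W Y ≡ length W C 2
  #within≡length-completeGraph {W} {Y} uW uY edgesY covers = begin
    #within W Y                    ≡⟨ count≡length-filter (within? W) Y ⟩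
    length (filter (within? W) Y)  ≡⟨ ≤-antisym (Unique-⊆⇒length≤ (filter⁺ (within? W) uY) inside)
                                                (Unique-⊆⇒length≤ (completeGraph-unique uW) claimed) ⟩
    length (completeGraph W)       ≡⟨ length-completeGraph W ⟩
    length W C 2                   ∎
    where
    open ≡-Reasoning
    inside : filter (within? W) Y ⊆ completeGraph W
    inside e∈ with ∈-filter⁻ (within? W) e∈
    ... | e∈Y , within = ∈-completeGraph⁺ (All.lookup edgesY e∈Y) within
    claimed : completeGraph W ⊆ filter (within? W) Y
    claimed e∈ with ∈-completeGraph⁻ uW e∈
    ... | isEdge , within = ∈-filter⁺ (within? W) (covers isEdge within) within

  module _ {Q : Pred (Fin n) 0ℓ} (Q? : Decidable Q) (W : List (Fin n)) where

    private
      within-parts-disjoint : ∀ {e} → Within (filter Q? W) e → ¬ Within (filter (∁? Q?) W) e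
      within-parts-disjoint (a∈K , _) (a∈R , _) =
        proj₂ (∈-filter⁻ (∁? Q?) {xs = W} a∈R) (proj₂ (∈-filter⁻ Q? {xs = W} a∈K))

      ⊆W : ∀ {P : Pred (Fin n) 0ℓ} (P? : Decidable P) {e} → Within (filter P? W) e → Within W e
      ⊆W P? (a∈ , b∈) = proj₁ (∈-filter⁻ P? {xs = W} a∈) , proj₁ (∈-filter⁻ P? {xs = W} b∈)

    #within-filter+#within-∁≤#within : ∀ X →
      #within (filter Q? W) X + #within (filter (∁? Q?) W) X ≤ #within W X
    #within-filter+#within-∁≤#within =
      count-disjoint≤count (within? _) (within? _) (within? W) within-parts-disjoint (⊆W Q?) (⊆W (∁? Q?))

    #within≤#within-filter+#within-∁ : ∀ {G} → Closed G Q →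
      #within W G ≤ #within (filter Q? W) G + #within (filter (∁? Q?) W) G
    #within≤#within-filter+#within-∁ {G} closed =
      count≤count-covering (within? _) (within? _) (within? W) within-parts-disjoint (⊆W Q?) (⊆W (∁? Q?))
        G cover
      where
      cover : ∀ {e} → e ∈ G → Within W e → Within (filter Q? W) e ⊎ Within (filter (∁? Q?) W) e
      cover {e} e∈G (a∈W , b∈W) with Q? (proj₁ e)
      ... | yes qa = inj₁ (∈-filter⁺ Q? a∈W qa , ∈-filter⁺ Q? b∈W (closed (inj₁ e∈G) qa))
      ... | no ¬qa = inj₂ (∈-filter⁺ (∁? Q?) a∈W ¬qa , ∈-filter⁺ (∁? Q?) b∈W (∁-closed closed (inj₁ e∈G) ¬qa))

    filter-closed : ∀ {G} → Closed G (_∈ W) → Closed G Q → Closed G (_∈ filter Q? W)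
    filter-closed closedW closedQ adj v∈ with ∈-filter⁻ Q? {xs = W} v∈
    ... | v∈W , qv = ∈-filter⁺ Q? (closedW adj v∈W) (closedQ adj qv)

-- The invariant maintained by Blocker's strategy

module _ {n : ℕ} where

  private
    variable
      G B : List (Edge n)
      c b : Edge n

  Balanced : List (Edge n) → List (Edge n) → Set
  Balanced G B = ∀ W → Unique W → Closed G (_∈ W) → #within W G ≤ #within W B + ⌊ length W /2⌋

  -- Every edge of K_n inside u's component of G has been claimed, in counting form.
  ComponentSaturated : List (Edge n) → List (Edge n) → Fin n → Set
  ComponentSaturated G B u =
    ∀ K → Unique K → All (Conn G u) K → #within K G + #within K B ≡ length K C 2

  #within-++ʳ : ∀ W (B bs : List (Edge n)) → #within W B ≤ #within W (B ++ bs)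
  #within-++ʳ W B bs = subst (#within W B ≤_) (sym (count-++ (within? W) B bs)) (m≤m+n _ _)

  balanced-[] : Balanced [] []
  balanced-[] W _ _ = m≤m+n (#within W []) ⌊ length W /2⌋

  balanced-++ʳ : ∀ bs → Balanced G B → Balanced G (B ++ bs)
  balanced-++ʳ {B = B} bs balanced W uW closed =
    ≤-trans (balanced W uW closed) (+-monoˡ-≤ ⌊ length W /2⌋ (#within-++ʳ W B bs))

  balanced-∷ʳ-outside : ∀ {W} → Balanced G B → Unique W → Closed (G ++ [ c ]) (_∈ W) → ¬ Within W c →
                        #within W (G ++ [ c ]) ≤ #within W B + ⌊ length W /2⌋
  balanced-∷ʳ-outside {G = G} {W = W} balanced uW closed c∉W =
    subst (_≤ _) (sym (count-∷ʳ-reject (within? W) G c∉W)) (balanced W uW (Closed-++ˡ closed))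

  -- The slack is even because C(|W|,2) + ⌊|W|/2⌋ is, which rules out a slack of -1.
  balanced-∷ʳ-saturated-within : ∀ {W} → Balanced G B → Unique W → Closed (G ++ [ c ]) (_∈ W) → Within W c →
    #within W (G ++ [ c ]) + #within W B ≡ length W C 2 →
    #within W (G ++ [ c ]) ≤ #within W B + ⌊ length W /2⌋
  balanced-∷ʳ-saturated-within {G = G} {B = B} {c = c} {W = W} balanced uW closed c∈W saturated
    with nC2+⌊n/2⌋-even (length W)
  ... | m , even = m≤1+n∧m+n-even⇒m≤n {o = m} almost (begin
    g′ + (#within W B + h)   ≡⟨ +-assoc g′ (#within W B) h ⟨
    g′ + #within W B + h     ≡⟨ cong (_+ h) saturated ⟩
    length W C 2 + h         ≡⟨ even ⟩
    m + m                    ∎)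
    where
    open ≡-Reasoning
    g′ = #within W (G ++ [ c ])
    h  = ⌊ length W /2⌋
    almost : g′ ≤ suc (#within W B + h)
    almost = subst (_≤ suc (#within W B + h)) (sym (count-∷ʳ-accept (within? W) G c∈W))
                   (s≤s (balanced W uW (Closed-++ˡ closed)))

  balanced-∷ʳ-answered : Balanced G B → InComponentOf (G ++ [ c ]) c b → Balanced (G ++ [ c ]) (B ++ [ b ])
  balanced-∷ʳ-answered {G = G} {B = B} {c = c} {b = b} balanced (u~b₁ , u~b₂) W uW closed with within? W c
  ... | no c∉W  =
    ≤-trans (balanced-∷ʳ-outside balanced uW closed c∉W) (+-monoˡ-≤ ⌊ length W /2⌋ (#within-++ʳ W B [ b ]))
  ... | yes c∈W = begin
    #within W (G ++ [ c ])         ≡⟨ count-∷ʳ-accept (within? W) G c∈W ⟩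
    suc (#within W G)              ≤⟨ s≤s (balanced W uW (Closed-++ˡ closed)) ⟩
    suc (#within W B) + h          ≡⟨ cong (_+ h) (count-∷ʳ-accept (within? W) B b∈W) ⟨
    #within W (B ++ [ b ]) + h     ∎
    where
    open ≤-Reasoning
    h = ⌊ length W /2⌋
    b∈W : Within W b
    b∈W = Closed-Conn closed (proj₁ c∈W) u~b₁ , Closed-Conn closed (proj₁ c∈W) u~b₂

  balanced-∷ʳ-saturated : Balanced G B → ComponentSaturated (G ++ [ c ]) B (proj₁ c) → Balanced (G ++ [ c ]) B
  balanced-∷ʳ-saturated {G = G} {B = B} {c = c} balanced saturated W uW closed with within? W c
  ... | no c∉W  = balanced-∷ʳ-outside balanced uW closed c∉W
  ... | yes (a∈W , b∈W) = begin
    #within W G′                                        ≤⟨ #within≤#within-filter+#within-∁ Q? W Conn-closed ⟩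
    #within K G′ + #within R G′                         ≤⟨ +-mono-≤ K-bound R-bound ⟩
    (#within K B + ⌊ length K /2⌋) + (#within R B + ⌊ length R /2⌋)
                                                        ≡⟨ regroup (#within K B) _ _ _ ⟩
    (#within K B + #within R B) + (⌊ length K /2⌋ + ⌊ length R /2⌋)
                                                        ≤⟨ +-mono-≤ (#within-filter+#within-∁≤#within Q? W B)
                                                                    (⌊m/2⌋+⌊n/2⌋≤⌊m+n/2⌋ (length K) (length R)) ⟩
    #within W B + ⌊ length K + length R /2⌋
                                                        ≡⟨ cong (λ k → #within W B + ⌊ k /2⌋) (length-filter+length-filter-∁ Q? W) ⟩
    #within W B + ⌊ length W /2⌋                        ∎
    where
    open ≤-Reasoning
    G′ = G ++ [ c ]
    Q? = Conn? G′ (proj₁ c)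
    K = filter Q? W
    R = filter (∁? Q?) W
    uK : Unique K
    uK = filter⁺ Q? uW
    closedK : Closed G′ (_∈ K)
    closedK = filter-closed Q? W closed Conn-closed
    c∈K : Within K c
    c∈K = ∈-filter⁺ Q? a∈W here , ∈-filter⁺ Q? b∈W (step here (inj₁ (∈-++⁺ʳ G (here refl))))
    K-bound : #within K G′ ≤ #within K B + ⌊ length K /2⌋
    K-bound = balanced-∷ʳ-saturated-within balanced uK closedK c∈K
      (saturated K uK (All.tabulate λ v∈K → proj₂ (∈-filter⁻ Q? {xs = W} v∈K)))
    c∉R : ¬ Within R c
    c∉R (a∈R , _) = proj₂ (∈-filter⁻ (∁? Q?) {xs = W} a∈R) here
    R-bound : #within R G′ ≤ #within R B + ⌊ length R /2⌋
    R-bound = balanced-∷ʳ-outside balanced (filter⁺ (∁? Q?) uW)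
      (filter-closed (∁? Q?) W closed (∁-closed Conn-closed)) c∉R
    regroup : ∀ a b c d → (a + b) + (c + d) ≡ (a + c) + (b + d)
    regroup = solve-∀

module _ {A : Set} where

  data EvenLength : List A → Set where
    []    : EvenLength []
    pair : ∀ {x y xs} → EvenLength xs → EvenLength (x ∷ y ∷ xs)

  private
    variable
      xs ys : List A

  EvenLength-++ : EvenLength xs → EvenLength ys → EvenLength (xs ++ ys)
  EvenLength-++ []               e = e
  EvenLength-++ (pair exs) e = pair (EvenLength-++ exs e)

  EvenLength⇒length≡2* : EvenLength xs → ∃[ k ] length xs ≡ 2 * k
  EvenLength⇒length≡2* []              = 0 , refl
  EvenLength⇒length≡2* (pair exs) with EvenLength⇒length≡2* exs
  ... | k , eq = suc k , trans (cong (λ l → suc (suc l)) eq) (sym (*-suc 2 k))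

  evens-++ : EvenLength xs → evens (xs ++ ys) ≡ evens xs ++ evens ys
  evens-++ []              = refl
  evens-++ (pair {x} exs) = cong (x ∷_) (evens-++ exs)

  odds-++ : EvenLength xs → odds (xs ++ ys) ≡ odds xs ++ odds ys
  odds-++ []              = refl
  odds-++ (pair {y = y} exs) = cong (y ∷_) (odds-++ exs)

  evens-⊆ : evens xs ⊆ xs
  odds-⊆  : odds xs ⊆ xs
  evens-⊆ {x ∷ xs} (here eq) = here eq
  evens-⊆ {x ∷ xs} (there p) = there (odds-⊆ p)
  odds-⊆  {x ∷ xs} p         = there (evens-⊆ p)

  evens-unique : Unique xs → Unique (evens xs)
  odds-unique  : Unique xs → Unique (odds xs)
  evens-unique {[]}     []          = []
  evens-unique {x ∷ xs} (x∉xs ∷ u) = All.tabulate (λ p → All.lookup x∉xs (odds-⊆ p)) ∷ odds-unique u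
  odds-unique  {[]}     []          = []
  odds-unique  {x ∷ xs} (_ ∷ u)     = evens-unique u

  evens-odds-disjoint : ∀ {x} → Unique xs → x ∈ evens xs → x ∉ odds xs
  evens-odds-disjoint {x ∷ xs} (x∉xs ∷ _) (here refl) p = All.lookup x∉xs (evens-⊆ p) refl
  evens-odds-disjoint {x ∷ xs} (_ ∷ u)    (there p)   q = evens-odds-disjoint u q p

  Unique-++⁻ˡ : Unique (xs ++ ys) → Unique xs
  Unique-++⁻ˡ {[]}     _          = []
  Unique-++⁻ˡ {x ∷ xs} (x∉ ∷ u) = ++⁻ˡ xs x∉ ∷ Unique-++⁻ˡ u

module _ {n : ℕ} {play : List (Edge n)} (legal : LegalPlay play) (strategy : BlockerFollowsStrategy play) where

  claimed-prefix : ∀ {pre c rest} → play ≡ pre ++ c ∷ rest → Unique (pre ++ [ c ]) × All IsEdge (pre ++ [ c ])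
  claimed-prefix {pre} {c} {rest} refl =
    Unique-++⁻ˡ (subst Unique split (proj₂ legal)) , ++⁻ˡ (pre ++ [ c ]) (subst (All IsEdge) split (proj₁ legal))
    where
    split : pre ++ c ∷ rest ≡ (pre ++ [ c ]) ++ rest
    split = sym (++-assoc pre [ c ] rest)

  saturated-if-unanswered : ∀ {pre c rest} → play ≡ pre ++ c ∷ rest → EvenLength pre →
    (∀ {b rest′} → rest ≡ b ∷ rest′ → ¬ InComponentOf (evens pre ++ [ c ]) c b) →
    ComponentSaturated (evens pre ++ [ c ]) (odds pre) (proj₁ c)
  saturated-if-unanswered {pre} {c} {rest} play≡ epre unanswered K uK inComponent = begin
    #within K (evens pre ++ [ c ]) + #within K (odds pre)
      ≡⟨ cong₂ (λ g b → #within K g + #within K b) (evens-++ epre) odds-claimed ⟨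
    #within K (evens claimed) + #within K (odds claimed)
      ≡⟨ count≡count-evens+count-odds (within? K) claimed ⟨
    #within K claimed
      ≡⟨ #within≡length-completeGraph uK (proj₁ (claimed-prefix play≡)) (proj₂ (claimed-prefix play≡)) covers ⟩
    length K C 2
      ∎
    where
    open ≡-Reasoning
    claimed = pre ++ [ c ]
    odds-claimed : odds claimed ≡ odds pre
    odds-claimed = trans (odds-++ epre) (++-identityʳ (odds pre))
    inComponentOf-claimed : ∀ {e} → InComponentOf (evens pre ++ [ c ]) c e → InComponentOf (evens claimed) c e
    inComponentOf-claimed = subst (λ g → InComponentOf g c _) (sym (evens-++ epre))
    covers : ∀ {e} → IsEdge e → Within K e → e ∈ claimed
    covers {e} isEdge (a∈K , b∈K) with e ∈ₑ? claimed
    ... | yes e∈ = e∈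
    ... | no  e∉ with strategy pre c rest play≡ (EvenLength⇒length≡2* epre)
                       (e , isEdge , e∉ , inComponentOf-claimed (All.lookup inComponent a∈K , All.lookup inComponent b∈K))
    ...   | b , rest′ , refl , b-inComponent =
      contradiction (subst (λ g → InComponentOf g c b) (evens-++ epre) b-inComponent) (unanswered refl)

  balanced-from : ∀ pre rest → play ≡ pre ++ rest → EvenLength pre →
                  Balanced (evens pre) (odds pre) → Balanced (evens play) (odds play)
  balanced-from pre [] play≡ _ balanced =
    subst (λ p → Balanced (evens p) (odds p)) (sym (trans play≡ (++-identityʳ pre))) balanced
  balanced-from pre (c ∷ []) play≡ epre balanced =
    subst (λ p → Balanced (evens p) (odds p)) (sym play≡)
      (subst₂ Balanced (sym (evens-++ epre)) (sym (odds-++ epre))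
        (balanced-++ʳ [] (balanced-∷ʳ-saturated balanced (saturated-if-unanswered play≡ epre λ ()))))
  balanced-from pre (c ∷ b ∷ rest) play≡ epre balanced =
    balanced-from (pre ++ c ∷ b ∷ []) rest (trans play≡ (sym (++-assoc pre (c ∷ b ∷ []) rest)))
      (EvenLength-++ epre (pair []))
      (subst₂ Balanced (sym (evens-++ epre)) (sym (odds-++ epre)) round)
    where
    round : Balanced (evens pre ++ [ c ]) (odds pre ++ [ b ])
    round with InComponentOf? (evens pre ++ [ c ]) c b
    ... | yes answered = balanced-∷ʳ-answered balanced answered
    ... | no unanswered = balanced-++ʳ [ b ]
      (balanced-∷ʳ-saturated balanced (saturated-if-unanswered play≡ epre λ { refl → unanswered }))

module _ {n : ℕ} {G B : List (Edge n)} where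

  IsComponent⇒Closed : ∀ {V} → IsComponent G V → Closed G (_∈ V)
  IsComponent⇒Closed (_ , x , V≡[x]) adj v∈V =
    Equivalence.from (V≡[x] _) (step (Equivalence.to (V≡[x] _) v∈V) adj)

  balanced⇒many-non-constructor-edges : Balanced G B → Unique B → All IsEdge B → (∀ {e} → e ∈ B → e ∉ G) →
                                       ∀ {V} → IsComponent G V → ManyNonConstructorEdges G V
  balanced⇒many-non-constructor-edges balanced uB edgesB B∩G=∅ {V} component@(uV , _) =
    L , filter⁺ (∁? (_∈ₑ? G)) (completeGraph-unique uV) , All.tabulate L-edges , (begin
      length V C 2                                           ≡⟨ length-completeGraph V ⟨
      length (completeGraph V)                               ≡⟨ length-filter+length-filter-∁ (_∈ₑ? G) (completeGraph V) ⟨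
      length (filter (_∈ₑ? G) (completeGraph V)) + length L  ≤⟨ +-monoˡ-≤ (length L) G-bound ⟩
      length L + h + length L                                ≡⟨ regroup (length L) h ⟩
      2 * length L + h                                       ≡⟨ cong (2 * length L +_) (⌊n/2⌋≡n/2 (length V)) ⟩
      2 * length L + length V / 2                            ∎)
    where
    open ≤-Reasoning
    h = ⌊ length V /2⌋
    L = filter (∁? (_∈ₑ? G)) (completeGraph V)
    L-edges : ∀ {e} → e ∈ L → IsEdge e × proj₁ e ∈ V × proj₂ e ∈ V × e ∉ G
    L-edges e∈L with ∈-filter⁻ (∁? (_∈ₑ? G)) {xs = completeGraph V} e∈L
    ... | e∈complete , e∉G with ∈-completeGraph⁻ uV e∈complete
    ...   | isEdge , a∈V , b∈V = isEdge , a∈V , b∈V , e∉G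
    G-bound : length (filter (_∈ₑ? G) (completeGraph V)) ≤ length L + h
    G-bound = begin
      length (filter (_∈ₑ? G) (completeGraph V))  ≤⟨ Unique-⊆⇒length≤ (filter⁺ (_∈ₑ? G) (completeGraph-unique uV)) in-G ⟩
      length (filter (within? V) G)               ≡⟨ count≡length-filter (within? V) G ⟨
      #within V G                                 ≤⟨ balanced V uV (IsComponent⇒Closed component) ⟩
      #within V B + h                             ≤⟨ +-monoˡ-≤ h B-bound ⟩
      length L + h                                ∎
      where
      in-G : filter (_∈ₑ? G) (completeGraph V) ⊆ filter (within? V) G
      in-G e∈ with ∈-filter⁻ (_∈ₑ? G) {xs = completeGraph V} e∈
      ... | e∈complete , e∈G = ∈-filter⁺ (within? V) e∈G (proj₂ (∈-completeGraph⁻ uV e∈complete))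
      in-L : filter (within? V) B ⊆ L
      in-L e∈ with ∈-filter⁻ (within? V) {xs = B} e∈
      ... | e∈B , within = ∈-filter⁺ (∁? (_∈ₑ? G)) (∈-completeGraph⁺ (All.lookup edgesB e∈B) within) (B∩G=∅ e∈B)
      B-bound : #within V B ≤ length L
      B-bound = begin
        #within V B                    ≡⟨ count≡length-filter (within? V) B ⟩
        length (filter (within? V) B)  ≤⟨ Unique-⊆⇒length≤ (filter⁺ (within? V) uB) in-L ⟩
        length L                       ∎
    regroup : ∀ l h → l + h + l ≡ 2 * l + h
    regroup = solve-∀

lemma2p4 : (n : ℕ) (play : List (Edge n)) → LegalPlay play
    → BlockerFollowsStrategy play
    → (C : List (Fin n)) → IsComponent (ConstructorGraph play) C
    → ManyNonConstructorEdges (ConstructorGraph play) C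
lemma2p4 n play legal@(edges , unique) strategy V component =
  balanced⇒many-non-constructor-edges
    (balanced-from legal strategy [] play refl [] balanced-[])
    (odds-unique unique) (All.tabulate (All.lookup edges ∘ odds-⊆))
    (λ e∈B e∈G → evens-odds-disjoint unique e∈G e∈B)
    component
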